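{- For any position $X$, the category $\mathcal W(X)$ of closed-world plays on $X$ is a preorder.
   Context: Base category. Let $\mathcal C$ be the category generated by the following graph modulo relations. Objects: $\star$; $[n]$ ($n\in\mathbb N$); for each $n$: $\mathrm{tick}_n,\mathrm{paral}_n,\mathrm{parar}_n,\nu_n,\mathrm{para}_n$; for $1\le i\le n$: $\iota^+_{n,i},\iota^-_{n,i}$; for $n,m$, $1\le i\le n$, $1\le j\le m$: $\tau_{n,i,m,j}$. Arrows: $d_1,\dots,d_n\colon\star\to[n]$; $s,t\colon[n]\to c$ for $c\in\{\mathrm{tick}_n,\mathrm{paral}_n,\mathrm{parar}_n,\iota^\pm_{n,i}\}$; $s\colon[n]\to\nu_n$, $t\colon[n+1]\to\nu_n$; $l\colon\mathrm{paral}_n\to\mathrm{para}_n$, $r\colon\mathrm{parar}_n\to\mathrm{para}_n$; $\epsilon\colon\iota^+_{n,i}\to\tau_{n,i,m,j}$, $\rho\colon\iota^-_{m,j}\to\tau_{n,i,m,j}$. Relations: $s\circ d_i=t\circ d_i$ ($1\le i\le n$) for each pair $s,t$ into a common object; $l\circ s=r\circ s$; $\epsilon\circ s\circ d_i=\rho\circ s\circ d_j$. $\widehat{\mathcal C}=[\mathcal C^{op},\mathbf{Set}]$. Positions: finite presheaves empty outside $\star$ and the $[n]$. Closed-world moves (cospans in $\widehat{\mathcal C}$ with interface, up to isomorphism): tick and channel creation $[n]\xrightarrow{s}c\xleftarrow{t}[n']$ for $c\in\{\mathrm{tick}_n,\nu_n\}$ ($n'=n+1$ for $\nu_n$, else $n$),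 interface $n\cdot\star$ via $[d_1,\dots,d_n]$; forking $[n]\xrightarrow{l\circ s}\mathrm{para}_n\leftarrow n|n$ with $n|n$ the pushout of $[n]\leftarrow n\cdot\star\to[n]$ (both $[d_1,\dots,d_n]$) and right map induced by $l\circ t,r\circ t$, interface $n\cdot\star$; synchronisation $n\bowtie_{i,j}m\xrightarrow{s'}\tau_{n,i,m,j}\xleftarrow{t'}n\bowtie_{i,j}m$ with $n\bowtie_{i,j}m$ the pushout of $[n]\xleftarrow{d_i}\star\xrightarrow{d_j}[m]$, $s'$ induced by $\epsilon\circ s,\rho\circ s$, $t'$ by $\epsilon\circ t,\rho\circ t$, interface the channels. An extended move is obtained by pushing a move with interface $I$ out along a morphism $I\to Z$ into a position $Z$. A closed-world play on $X$ is a mono $X\hookrightarrow U$ in $\widehat{\mathcal C}$ with $U$ the colimit of a finite or countably infinite chain $X\to M_0\leftarrow X_1\to M_1\leftarrow\cdots$ of extended closed-world moves. $\mathcal W(X)$ has these as objects, and as morphisms $(X\hookrightarrow U)\to(X\hookrightarrow U')$ the morphisms $k\colon U\to U'$ in $\widehat{\mathcal C}$ commuting with the inclusions of $X$. -}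

module Defs where

open import Data.Nat using (ℕ; zero; suc; _<_; _≤_; z≤n; s≤s)
open import Data.Nat.Properties using (<⇒≤)
open import Data.Fin using (Fin; inject₁)
open import Data.List using (List)
open import Data.List.Membership.Propositional using (_∈_)
open import Data.Product using (Σ; _×_; _,_; Σ-syntax)
open import Data.Sum using (_⊎_)
open import Data.Unit using (⊤; tt)
open import Relation.Nullary using (¬_)
open import Relation.Binary.PropositionalEquality using (_≡_; _≢_; trans; cong)

-- The base category C, presented by generators and relations.
-- Indices i with 1 ≤ i ≤ n are represented by Fin n (0-based).

data Obj : Set where
  star  : Obj
  ag    : ℕ → Obj
  tick  : ℕ → Obj
  paral : ℕ → Obj
  parar : ℕ → Obj
  nu    : ℕ → Obj
  para  : ℕ → Obj
  ι⁺    : (n : ℕ) → Fin n → Obj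
  ι⁻    : (n : ℕ) → Fin n → Obj
  τ     : (n : ℕ) → Fin n → (m : ℕ) → Fin m → Obj

data Gen : Obj → Obj → Set where
  d      : (n : ℕ) → Fin n → Gen star (ag n)
  sTick  : (n : ℕ) → Gen (ag n) (tick n)
  tTick  : (n : ℕ) → Gen (ag n) (tick n)
  sParal : (n : ℕ) → Gen (ag n) (paral n)
  tParal : (n : ℕ) → Gen (ag n) (paral n)
  sParar : (n : ℕ) → Gen (ag n) (parar n)
  tParar : (n : ℕ) → Gen (ag n) (parar n)
  sι⁺    : (n : ℕ) (i : Fin n) → Gen (ag n) (ι⁺ n i)
  tι⁺    : (n : ℕ) (i : Fin n) → Gen (ag n) (ι⁺ n i)
  sι⁻    : (n : ℕ) (i : Fin n) → Gen (ag n) (ι⁻ n i)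
  tι⁻    : (n : ℕ) (i : Fin n) → Gen (ag n) (ι⁻ n i)
  sNu    : (n : ℕ) → Gen (ag n) (nu n)
  tNu    : (n : ℕ) → Gen (ag (suc n)) (nu n)
  l      : (n : ℕ) → Gen (paral n) (para n)
  r      : (n : ℕ) → Gen (parar n) (para n)
  ε      : (n : ℕ) (i : Fin n) (m : ℕ) (j : Fin m) → Gen (ι⁺ n i) (τ n i m j)
  ρ      : (n : ℕ) (i : Fin n) (m : ℕ) (j : Fin m) → Gen (ι⁻ m j) (τ n i m j)

-- paths in the graph, in diagrammatic order: (g ∷ p) is "first g, then p",
-- i.e. the composite p ∘ g
infixr 5 _∷_
data Path : Obj → Obj → Set where
  []  : ∀ {a} → Path a a
  _∷_ : ∀ {a b c} → Gen a b → Path b c → Path a c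

data Rel : ∀ {a b} → Path a b → Path a b → Set where
  stTick  : ∀ n (i : Fin n) → Rel (d n i ∷ sTick n ∷ []) (d n i ∷ tTick n ∷ [])
  stParal : ∀ n (i : Fin n) → Rel (d n i ∷ sParal n ∷ []) (d n i ∷ tParal n ∷ [])
  stParar : ∀ n (i : Fin n) → Rel (d n i ∷ sParar n ∷ []) (d n i ∷ tParar n ∷ [])
  stι⁺    : ∀ n (k : Fin n) (i : Fin n) → Rel (d n i ∷ sι⁺ n k ∷ []) (d n i ∷ tι⁺ n k ∷ [])
  stι⁻    : ∀ n (k : Fin n) (i : Fin n) → Rel (d n i ∷ sι⁻ n k ∷ []) (d n i ∷ tι⁻ n k ∷ [])
  stNu    : ∀ n (i : Fin n) → Rel (d n i ∷ sNu n ∷ []) (d (suc n) (inject₁ i) ∷ tNu n ∷ [])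
  lr      : ∀ n → Rel (sParal n ∷ l n ∷ []) (sParar n ∷ r n ∷ [])
  ερ      : ∀ n (i : Fin n) m (j : Fin m) →
            Rel (d n i ∷ sι⁺ n i ∷ ε n i m j ∷ []) (d m j ∷ sι⁻ m j ∷ ρ n i m j ∷ [])

actOn : {A : Obj → Set} → (∀ {a b} → Gen a b → A b → A a) →
        ∀ {a b} → Path a b → A b → A a
actOn F₁ []      x = x
actOn F₁ (g ∷ p) x = F₁ g (actOn F₁ p x)

record Presheaf : Set₁ where
  field
    F₀   : Obj → Set
    F₁   : ∀ {a b} → Gen a b → F₀ b → F₀ a
    resp : ∀ {a b} {p q : Path a b} → Rel p q → ∀ x → actOn F₁ p x ≡ actOn F₁ q x

open Presheaf public

act : (F : Presheaf) → ∀ {a b} → Path a b → F₀ F b → F₀ F a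
act F = actOn (F₁ F)

record Hom (F G : Presheaf) : Set where
  field
    η   : ∀ c → F₀ F c → F₀ G c
    nat : ∀ {a b} (g : Gen a b) (x : F₀ F b) → η a (F₁ F g x) ≡ F₁ G g (η b x)

open Hom public

infix 4 _≈H_
_≈H_ : ∀ {F G} → Hom F G → Hom F G → Set
α ≈H β = ∀ c x → η α c x ≡ η β c x

infixr 9 _∘H_
_∘H_ : ∀ {F G H} → Hom G H → Hom F G → Hom F H
η   (α ∘H β) c x = η α c (η β c x)
nat (_∘H_ {F} {G} {H} α β) {a} {b} g x =
  trans (cong (η α a) (nat β g x)) (nat α g (η β b x))

∃!Hom : (F G : Presheaf) → (Hom F G → Set) → Set
∃!Hom F G P = Σ[ h ∈ Hom F G ] (P h × (∀ h' → P h' → h' ≈H h))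

IsMono : ∀ {F G} → Hom F G → Set₁
IsMono {F} {G} m = ∀ (W : Presheaf) (a b : Hom W F) → m ∘H a ≈H m ∘H b → a ≈H b

-- Y is representable at c with generic element y (Yoneda universal property);
-- i.e. Y ≅ y(c) with y corresponding to id_c.
IsRep : (c : Obj) (Y : Presheaf) → F₀ Y c → Set₁
IsRep c Y y = ∀ (F : Presheaf) (x : F₀ F c) → ∃!Hom Y F (λ h → η h c y ≡ x)

IsCoprodStar : (n : ℕ) (I : Presheaf) → (Fin n → F₀ I star) → Set₁
IsCoprodStar n I e =
  ∀ (F : Presheaf) (x : Fin n → F₀ F star) → ∃!Hom I F (λ h → ∀ k → η h star (e k) ≡ x k)

IsPushout : ∀ {A B C P} → Hom A B → Hom A C → Hom B P → Hom C P → Set₁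
IsPushout {A} {B} {C} {P} f g i j =
  (i ∘H f ≈H j ∘H g) ×
  (∀ (Q : Presheaf) (i' : Hom B Q) (j' : Hom C Q) → i' ∘H f ≈H j' ∘H g →
     ∃!Hom P Q (λ h → (h ∘H i ≈H i') × (h ∘H j ≈H j')))

data PosObj : Obj → Set where
  pstar : PosObj star
  pag   : ∀ n → PosObj (ag n)

Finite : Presheaf → Set
Finite F = Σ[ L ∈ List (Σ Obj (F₀ F)) ] (∀ c (x : F₀ F c) → (c , x) ∈ L)

Position : Presheaf → Set
Position F = Finite F × (∀ c → ¬ PosObj c → ¬ F₀ F c)

record Move : Set₁ where
  field
    I X M Y : Presheaf
    iX : Hom I X
    iY : Hom I Y
    s  : Hom X M
    t  : Hom Y M

-- tick:  [n] −s→ tick_n ←t− [n], interface n·⋆ via [d_1,…,d_n]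
IsTickMove : ℕ → Move → Set₁
IsTickMove n mv =
  Σ[ e ∈ (Fin n → F₀ I star) ] Σ[ x ∈ F₀ X (ag n) ] Σ[ m ∈ F₀ M (tick n) ] Σ[ y ∈ F₀ Y (ag n) ]
  ( IsCoprodStar n I e × IsRep (ag n) X x × IsRep (tick n) M m × IsRep (ag n) Y y
  × η s (ag n) x ≡ F₁ M (sTick n) m × η t (ag n) y ≡ F₁ M (tTick n) m
  × (∀ k → η iX star (e k) ≡ F₁ X (d n k) x)
  × (∀ k → η iY star (e k) ≡ F₁ Y (d n k) y) )
  where open Move mv

-- channel creation:  [n] −s→ ν_n ←t− [n+1], interface n·⋆ via [d_1,…,d_n]
IsNuMove : ℕ → Move → Set₁
IsNuMove n mv =
  Σ[ e ∈ (Fin n → F₀ I star) ] Σ[ x ∈ F₀ X (ag n) ] Σ[ m ∈ F₀ M (nu n) ] Σ[ y ∈ F₀ Y (ag (suc n)) ]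
  ( IsCoprodStar n I e × IsRep (ag n) X x × IsRep (nu n) M m × IsRep (ag (suc n)) Y y
  × η s (ag n) x ≡ F₁ M (sNu n) m × η t (ag (suc n)) y ≡ F₁ M (tNu n) m
  × (∀ k → η iX star (e k) ≡ F₁ X (d n k) x)
  × (∀ k → η iY star (e k) ≡ F₁ Y (d (suc n) (inject₁ k)) y) )
  where open Move mv

-- forking:  [n] −l∘s→ para_n ← n|n, with n|n the pushout of [n] ← n·⋆ → [n]
-- and the right map induced by l∘t, r∘t; interface n·⋆
IsForkMove : ℕ → Move → Set₁
IsForkMove n mv =
  Σ[ e ∈ (Fin n → F₀ I star) ] Σ[ x ∈ F₀ X (ag n) ] Σ[ m ∈ F₀ M (para n) ]
  Σ[ Y₁ ∈ Presheaf ] Σ[ Y₂ ∈ Presheaf ] Σ[ y₁ ∈ F₀ Y₁ (ag n) ] Σ[ y₂ ∈ F₀ Y₂ (ag n) ]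
  Σ[ a₁ ∈ Hom I Y₁ ] Σ[ a₂ ∈ Hom I Y₂ ] Σ[ in₁ ∈ Hom Y₁ Y ] Σ[ in₂ ∈ Hom Y₂ Y ]
  ( IsCoprodStar n I e × IsRep (ag n) X x × IsRep (para n) M m
  × IsRep (ag n) Y₁ y₁ × IsRep (ag n) Y₂ y₂
  × (∀ k → η a₁ star (e k) ≡ F₁ Y₁ (d n k) y₁)
  × (∀ k → η a₂ star (e k) ≡ F₁ Y₂ (d n k) y₂)
  × IsPushout a₁ a₂ in₁ in₂
  × (∀ k → η iX star (e k) ≡ F₁ X (d n k) x)
  × iY ≈H in₁ ∘H a₁
  × η s (ag n) x ≡ act M (sParal n ∷ l n ∷ []) m
  × η t (ag n) (η in₁ (ag n) y₁) ≡ act M (tParal n ∷ l n ∷ []) m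
  × η t (ag n) (η in₂ (ag n) y₂) ≡ act M (tParar n ∷ r n ∷ []) m )
  where open Move mv

IsChannelsOf : ∀ {I X} → Hom I X → Set
IsChannelsOf {I} {X} i =
  (∀ c → c ≢ star → ¬ F₀ I c)
  × (∀ w w' → η i star w ≡ η i star w' → w ≡ w')
  × (∀ (z : F₀ X star) → Σ[ w ∈ F₀ I star ] η i star w ≡ z)

-- synchronisation:  n⋈_{i,j}m −s'→ τ_{n,i,m,j} ←t'− n⋈_{i,j}m  with n⋈_{i,j}m the
-- pushout of [n] ←d_i− ⋆ −d_j→ [m]; s' induced by ε∘s, ρ∘s; t' by ε∘t, ρ∘t;
-- interface the channels.  (Source and target are two pushouts of the same span,
-- identified via the canonical iso θ.)
IsSyncMove : (n : ℕ) → Fin n → (m : ℕ) → Fin m → Move → Set₁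
IsSyncMove n i m j mv =
  Σ[ Rn ∈ Presheaf ] Σ[ Rm ∈ Presheaf ] Σ[ Rs ∈ Presheaf ]
  Σ[ a ∈ F₀ Rn (ag n) ] Σ[ b ∈ F₀ Rm (ag m) ] Σ[ c ∈ F₀ Rs star ] Σ[ μ ∈ F₀ M (τ n i m j) ]
  Σ[ f₁ ∈ Hom Rs Rn ] Σ[ f₂ ∈ Hom Rs Rm ]
  Σ[ in₁ ∈ Hom Rn X ] Σ[ in₂ ∈ Hom Rm X ] Σ[ in₁' ∈ Hom Rn Y ] Σ[ in₂' ∈ Hom Rm Y ]
  Σ[ θ ∈ Hom X Y ]
  ( IsRep (ag n) Rn a × IsRep (ag m) Rm b × IsRep star Rs c × IsRep (τ n i m j) M μ
  × η f₁ star c ≡ F₁ Rn (d n i) a × η f₂ star c ≡ F₁ Rm (d m j) b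
  × IsPushout f₁ f₂ in₁ in₂ × IsPushout f₁ f₂ in₁' in₂'
  × θ ∘H in₁ ≈H in₁' × θ ∘H in₂ ≈H in₂'
  × η s (ag n) (η in₁ (ag n) a) ≡ act M (sι⁺ n i ∷ ε n i m j ∷ []) μ
  × η s (ag m) (η in₂ (ag m) b) ≡ act M (sι⁻ m j ∷ ρ n i m j ∷ []) μ
  × η t (ag n) (η in₁' (ag n) a) ≡ act M (tι⁺ n i ∷ ε n i m j ∷ []) μ
  × η t (ag m) (η in₂' (ag m) b) ≡ act M (tι⁻ m j ∷ ρ n i m j ∷ []) μ
  × IsChannelsOf iX
  × iY ≈H θ ∘H iX )
  where open Move mv

-- closed-world moves (each kind characterised up to isomorphism)
IsMove : Move → Set₁
IsMove mv =
  (Σ[ n ∈ ℕ ] IsTickMove n mv)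
  ⊎ (Σ[ n ∈ ℕ ] IsNuMove n mv)
  ⊎ (Σ[ n ∈ ℕ ] IsForkMove n mv)
  ⊎ (Σ[ n ∈ ℕ ] Σ[ i ∈ Fin n ] Σ[ m ∈ ℕ ] Σ[ j ∈ Fin m ] IsSyncMove n i m j mv)

-- A −f→ B ←g− C is an extended closed-world move: the pushout of a move
-- along some h : I → Z into a position Z.
IsExtMove : ∀ {A B C} → Hom A B → Hom C B → Set₁
IsExtMove {A} {B} {C} f g =
  Σ[ mv ∈ Move ] (IsMove mv ×
  (Σ[ Z ∈ Presheaf ] Σ[ h ∈ Hom (Move.I mv) Z ]
   Σ[ xA ∈ Hom (Move.X mv) A ] Σ[ zA ∈ Hom Z A ]
   Σ[ mB ∈ Hom (Move.M mv) B ] Σ[ zB ∈ Hom Z B ]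
   Σ[ yC ∈ Hom (Move.Y mv) C ] Σ[ zC ∈ Hom Z C ]
   ( Position Z
   × IsPushout (Move.iX mv) h xA zA
   × IsPushout (Move.s mv ∘H Move.iX mv) h mB zB
   × IsPushout (Move.iY mv) h yC zC
   × f ∘H xA ≈H mB ∘H Move.s mv × f ∘H zA ≈H zB
   × g ∘H yC ≈H mB ∘H Move.t mv × g ∘H zC ≈H zB )))

-- Chains  X = X₀ → M₀ ← X₁ → M₁ ← ⋯  (finite of length n, or infinite)

data Len : Set where
  fin : ℕ → Len      -- n moves: X₀ … X_n, M₀ … M_{n-1}
  inf : Len

_<ᴸ_ : ℕ → Len → Set
k <ᴸ fin n = k < n
k <ᴸ inf   = ⊤

_≤ᴸ_ : ℕ → Len → Set
k ≤ᴸ fin n = k ≤ n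
k ≤ᴸ inf   = ⊤

<ᴸ⇒≤ᴸ : ∀ k L → k <ᴸ L → k ≤ᴸ L
<ᴸ⇒≤ᴸ k (fin n) p = <⇒≤ p
<ᴸ⇒≤ᴸ k inf     p = tt

<ᴸ⇒suc≤ᴸ : ∀ k L → k <ᴸ L → suc k ≤ᴸ L
<ᴸ⇒suc≤ᴸ k (fin n) p = p
<ᴸ⇒suc≤ᴸ k inf     p = tt

0≤ᴸ : ∀ L → 0 ≤ᴸ L
0≤ᴸ (fin n) = z≤n
0≤ᴸ inf     = tt

chainPos : Presheaf → (ℕ → Presheaf) → ℕ → Presheaf
chainPos X next zero    = X
chainPos X next (suc k) = next k

record Chain (X : Presheaf) : Set₁ where
  field
    len  : Len
    next : ℕ → Presheaf
    Ms   : ℕ → Presheaf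
    f    : ∀ k → Hom (chainPos X next k) (Ms k)
    g    : ∀ k → Hom (next k) (Ms k)
    ext  : ∀ k → k <ᴸ len → IsExtMove (f k) (g k)

  Xs : ℕ → Presheaf
  Xs = chainPos X next

record Cocone {X : Presheaf} (C : Chain X) (Q : Presheaf) : Set where
  open Chain C
  field
    u    : ∀ k → k ≤ᴸ len → Hom (Xs k) Q
    v    : ∀ k → k <ᴸ len → Hom (Ms k) Q
    comf : ∀ k (p : k <ᴸ len) → v k p ∘H f k ≈H u k (<ᴸ⇒≤ᴸ k len p)
    comg : ∀ k (p : k <ᴸ len) → v k p ∘H g k ≈H u (suc k) (<ᴸ⇒suc≤ᴸ k len p)

IsColimit : ∀ {X} (C : Chain X) (U : Presheaf) → Cocone C U → Set₁
IsColimit C U κ =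
  ∀ (Q : Presheaf) (κ' : Cocone C Q) →
  ∃!Hom U Q (λ h → (∀ k p → h ∘H Cocone.u κ k p ≈H Cocone.u κ' k p)
                  × (∀ k p → h ∘H Cocone.v κ k p ≈H Cocone.v κ' k p))

record Play (X : Presheaf) : Set₁ where
  field
    chain  : Chain X
    U      : Presheaf
    cocone : Cocone chain U
    colim  : IsColimit chain U cocone

  incl : Hom X U
  incl = Cocone.u cocone 0 (0≤ᴸ (Chain.len chain))

  field
    mono : IsMono incl

record WHom {X : Presheaf} (P P' : Play X) : Set where
  field
    k    : Hom (Play.U P) (Play.U P')
    comm : k ∘H Play.incl P ≈H Play.incl P'

IsPreorderW : Presheaf → Set₁
IsPreorderW X = ∀ (P P' : Play X) (α β : WHom P P') → WHom.k α ≈H WHom.k β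

module Submission where

-- The apices tick_n, ν_n, para_n, τ_{n,i,m,j} of moves are the *top objects*;
-- each has a *principal face* [n] → c, the agent its move consumes.  A
-- presheaf is *face-injective* if its top elements are determined by their
-- principal faces.  The proof has two halves.
--  * `agreeOnPlay`: maps from a play U into a face-injective presheaf that
--    agree on X agree everywhere.  By induction along the chain they agree on
--    each X_k and M_k = M +_I Z: on Z since Z → M_k factors through X_k, on the
--    representable apex M since its generic element is fixed by its principal
--    face, which lies in X_k.
--  * `PlayFaces.faceInjective`: the colimit U' of a play is face-injective.
--    Every top element of U' is the apex of some move (`locate`), and moves at
--    different stages consume different agents (`agentsDistinct`): for a stage
--    j₀, a cocone into a Boolean labelling presheaf Q marks exactly the agents
--    that survive unchanged until they are consumed at stage j₀.
-- Both halves rest on "induction principles" for top elements of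
-- representables, pushouts and plays, obtained from universal properties via
-- sub-presheaves (`TopRestriction`), and on a uniform description `MoveShape`
-- of the four kinds of moves.

open import Defs
open import Data.Nat using (ℕ; zero; suc; _+_; _∸_; _≤_)
open import Data.Nat.Properties
  using (≤-irrelevant; ≡-irrelevant; _<?_; _≤?_; _≟_; +-suc; +-identityʳ; +-cancelˡ-≡;
         m≤m+n; m+[n∸m]≡n; ≤-<-trans; <-irrefl; ≤-refl; ≤-trans; n≤1+n)
open import Data.Bool using (Bool; true; false)
open import Data.Product using (Σ; _×_; _,_; proj₁; proj₂)
open import Data.Product.Properties.WithK using (,-injectiveʳ)
open import Data.Sum using (inj₁; inj₂)
open import Data.Unit using (⊤; tt)
open import Data.Empty using (⊥; ⊥-elim)
open import Function using (_∘_)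
open import Relation.Nullary using (¬_; Dec; yes; no; does)
open import Relation.Nullary.Decidable using (recompute; dec-true; dec-false)
open import Relation.Binary.PropositionalEquality
  using (_≡_; _≢_; refl; sym; trans; cong; subst; module ≡-Reasoning)
open import Axiom.UniquenessOfIdentityProofs.WithK using (uip)

idH : ∀ {F} → Hom F F
η idH c x = x
nat idH g x = refl

actHom : ∀ {F G} (h : Hom F G) {a b} (p : Path a b) (x : F₀ F b) →
         η h a (act F p x) ≡ act G p (η h b x)
actHom h []      x = refl
actHom {F} {G} h (g ∷ p) x = trans (nat h g (act F p x)) (cong (F₁ G g) (actHom h p x))

-- Representability and pushouts wrapped as records, so that the objects and
-- morphisms involved are inferred from the proof.
record Representable (c : Obj) (Y : Presheaf) (y : F₀ Y c) : Set₁ where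
  constructor representable
  field universal : IsRep c Y y

record Pushout {A B C P} (f : Hom A B) (g : Hom A C) (i : Hom B P) (j : Hom C P) : Set₁ where
  constructor pushout
  field universal : IsPushout f g i j

repMed : ∀ {c Y y} → Representable c Y y → ∀ F (x : F₀ F c) → Σ (Hom Y F) (λ h → η h c y ≡ x)
repMed (representable rep) F x = proj₁ (rep F x) , proj₁ (proj₂ (rep F x))

repUnique : ∀ {c Y y} → Representable c Y y → ∀ {F} (h h' : Hom Y F) →
            η h c y ≡ η h' c y → h ≈H h'
repUnique {c} {y = y} (representable rep) {F} h h' e c' x =
  trans (uniq h e c' x) (sym (uniq h' refl c' x))
  where uniq = proj₂ (proj₂ (rep F (η h' c y)))

poMed : ∀ {A B C P} {f : Hom A B} {g : Hom A C} {i : Hom B P} {j : Hom C P} →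
        Pushout f g i j → ∀ {Q} (i' : Hom B Q) (j' : Hom C Q) → i' ∘H f ≈H j' ∘H g →
        Σ (Hom P Q) (λ h → (h ∘H i ≈H i') × (h ∘H j ≈H j'))
poMed (pushout (_ , up)) {Q} i' j' e = proj₁ (up Q i' j' e) , proj₁ (proj₂ (up Q i' j' e))

poUnique : ∀ {A B C P} {f : Hom A B} {g : Hom A C} {i : Hom B P} {j : Hom C P} →
           Pushout f g i j → ∀ {Q} (h h' : Hom P Q) →
           h ∘H i ≈H h' ∘H i → h ∘H j ≈H h' ∘H j → h ≈H h'
poUnique {i = i} {j} (pushout (square , up)) {Q} h h' ei ej c x =
  trans (uniq h ((λ _ _ → refl) , (λ _ _ → refl)) c x)
        (sym (uniq h' ((λ c y → sym (ei c y)) , (λ c y → sym (ej c y))) c x))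
  where uniq = proj₂ (proj₂ (up Q (h ∘H i) (h ∘H j) (λ c y → cong (η h c) (square c y))))

playMed : ∀ {X} (P : Play X) (Q : Presheaf) (κ : Cocone (Play.chain P) Q) →
  Σ (Hom (Play.U P) Q) (λ h → (∀ k p → h ∘H Cocone.u (Play.cocone P) k p ≈H Cocone.u κ k p)
                             × (∀ k p → h ∘H Cocone.v (Play.cocone P) k p ≈H Cocone.v κ k p))
playMed P Q κ = proj₁ (Play.colim P Q κ) , proj₁ (proj₂ (Play.colim P Q κ))

playUnique : ∀ {X} (P : Play X) {Q} (h h' : Hom (Play.U P) Q) →
  (∀ k p → h ∘H Cocone.u (Play.cocone P) k p ≈H h' ∘H Cocone.u (Play.cocone P) k p) →
  (∀ k p → h ∘H Cocone.v (Play.cocone P) k p ≈H h' ∘H Cocone.v (Play.cocone P) k p) → h ≈H h'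
playUnique P {Q} h h' eu ev c x =
  trans (uniq h ((λ _ _ _ _ → refl) , (λ _ _ _ _ → refl)) c x)
        (sym (uniq h' ((λ k p c y → sym (eu k p c y)) , (λ k p c y → sym (ev k p c y))) c x))
  where
  κ = Play.cocone P
  hκ : Cocone (Play.chain P) Q
  Cocone.u hκ k p = h ∘H Cocone.u κ k p
  Cocone.v hκ k p = h ∘H Cocone.v κ k p
  Cocone.comf hκ k p c y = cong (η h c) (Cocone.comf κ k p c y)
  Cocone.comg hκ k p c y = cong (η h c) (Cocone.comg κ k p c y)
  uniq = proj₂ (proj₂ (Play.colim P Q hκ))

data Top : Obj → Set where
  topTick : ∀ n → Top (tick n)
  topNu   : ∀ n → Top (nu n)
  topPara : ∀ n → Top (para n)
  topTau  : ∀ n i m j → Top (τ n i m j)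

topIrr : ∀ {c} (t t' : Top c) → t ≡ t'
topIrr (topTick n)      (topTick .n)         = refl
topIrr (topNu n)        (topNu .n)           = refl
topIrr (topPara n)      (topPara .n)         = refl
topIrr (topTau n i m j) (topTau .n .i .m .j) = refl

-- Each top object has a principal face [n] → c: the agent its move consumes
-- (for a synchronisation, the emitting agent).
arity : ∀ {c} → Top c → ℕ
arity (topTick n)      = n
arity (topNu n)        = n
arity (topPara n)      = n
arity (topTau n i m j) = n

principalFace : ∀ {c} (t : Top c) → Path (ag (arity t)) c
principalFace (topTick n)      = sTick n ∷ []
principalFace (topNu n)        = sNu n ∷ []
principalFace (topPara n)      = sParal n ∷ l n ∷ []
principalFace (topTau n i m j) = sι⁺ n i ∷ ε n i m j ∷ []

genSourceNotTop : ∀ {a b} → Gen a b → ¬ Top a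
genSourceNotTop (d n x) ()
genSourceNotTop (sTick n) ()
genSourceNotTop (tTick n) ()
genSourceNotTop (sParal n) ()
genSourceNotTop (tParal n) ()
genSourceNotTop (sParar n) ()
genSourceNotTop (tParar n) ()
genSourceNotTop (sι⁺ n i) ()
genSourceNotTop (tι⁺ n i) ()
genSourceNotTop (sι⁻ n i) ()
genSourceNotTop (tι⁻ n i) ()
genSourceNotTop (sNu n) ()
genSourceNotTop (tNu n) ()
genSourceNotTop (l n) ()
genSourceNotTop (r n) ()
genSourceNotTop (ε n i m j) ()
genSourceNotTop (ρ n i m j) ()

relSourceNotTop : ∀ {a b} {p q : Path a b} → Rel p q → ¬ Top a
relSourceNotTop (stTick n i)   ()
relSourceNotTop (stParal n i)  ()
relSourceNotTop (stParar n i)  ()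
relSourceNotTop (stι⁺ n k i)   ()
relSourceNotTop (stι⁻ n k i)   ()
relSourceNotTop (stNu n i)     ()
relSourceNotTop (lr n)         ()
relSourceNotTop (ερ n i m j)   ()

NoTop : Presheaf → Set
NoTop F = ∀ {c} → Top c → ¬ F₀ F c

positionNoTop : ∀ {Z} → Position Z → NoTop Z
positionNoTop (_ , empty) (topTick n)      = empty _ (λ ())
positionNoTop (_ , empty) (topNu n)        = empty _ (λ ())
positionNoTop (_ , empty) (topPara n)      = empty _ (λ ())
positionNoTop (_ , empty) (topTau n i m j) = empty _ (λ ())

OnTop : Obj → Set → Set
OnTop (tick n)    A = A
OnTop (nu n)      A = A
OnTop (para n)    A = A
OnTop (τ n i m j) A = A
OnTop _           A = ⊤

onTop : ∀ c {A : Set} → (Top c → A) → OnTop c A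
onTop (tick n)    k = k (topTick n)
onTop (nu n)      k = k (topNu n)
onTop (para n)    k = k (topPara n)
onTop (τ n i m j) k = k (topTau n i m j)
onTop star        k = tt
onTop (ag n)      k = tt
onTop (paral n)   k = tt
onTop (parar n)   k = tt
onTop (ι⁺ n i)    k = tt
onTop (ι⁻ n i)    k = tt

fromOnTop : ∀ {c} {A : Set} → Top c → OnTop c A → A
fromOnTop (topTick n)      a = a
fromOnTop (topNu n)        a = a
fromOnTop (topPara n)      a = a
fromOnTop (topTau n i m j) a = a

onTopTrivial : ∀ c {A : Set} → ¬ Top c → (a a' : OnTop c A) → a ≡ a'
onTopTrivial (tick n)    nt _ _ = ⊥-elim (nt (topTick n))
onTopTrivial (nu n)      nt _ _ = ⊥-elim (nt (topNu n))
onTopTrivial (para n)    nt _ _ = ⊥-elim (nt (topPara n))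
onTopTrivial (τ n i m j) nt _ _ = ⊥-elim (nt (topTau n i m j))
onTopTrivial star        nt _ _ = refl
onTopTrivial (ag n)      nt _ _ = refl
onTopTrivial (paral n)   nt _ _ = refl
onTopTrivial (parar n)   nt _ _ = refl
onTopTrivial (ι⁺ n i)    nt _ _ = refl
onTopTrivial (ι⁻ n i)    nt _ _ = refl

-- The sub-presheaf S ↪ P of elements whose top instances satisfy T.  Since no
-- generator starts at a top object, S is a presheaf for any T, and a morphism
-- into P factors through S as soon as its top values satisfy T.  If some
-- h : P → S splits the inclusion, every top element of P satisfies T; this is
-- how properties of top elements are proved by universal properties below.
module TopRestriction (P : Presheaf) (T : ∀ c → F₀ P c → Set) where

  S₀ : Obj → Set
  S₀ c = Σ (F₀ P c) (λ x → OnTop c (T c x))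

  S-≡ : ∀ c {y y' : S₀ c} → ¬ Top c → proj₁ y ≡ proj₁ y' → y ≡ y'
  S-≡ c {x , t} {.x , t'} nt refl = cong (x ,_) (onTopTrivial c nt t t')

  S₁ : ∀ {a b} → Gen a b → S₀ b → S₀ a
  S₁ {a} g (x , _) = F₁ P g x , onTop a (λ tp → ⊥-elim (genSourceNotTop g tp))

  actFst : ∀ {a b} (p : Path a b) (y : S₀ b) → proj₁ (actOn S₁ p y) ≡ act P p (proj₁ y)
  actFst []      y = refl
  actFst (g ∷ p) y = cong (F₁ P g) (actFst p y)

  S : Presheaf
  F₀ S = S₀
  F₁ S = S₁
  resp S {a} {p = p} {q} rel y =
    S-≡ a (relSourceNotTop rel)
        (trans (actFst p y) (trans (resp P rel (proj₁ y)) (sym (actFst q y))))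

  incl : Hom S P
  η incl c = proj₁
  nat incl g x = refl

  restrict : ∀ {F} (k : Hom F P) → (∀ {c} → Top c → (x : F₀ F c) → T c (η k c x)) → Hom F S
  η (restrict k t) c x = η k c x , onTop c (λ tp → t tp x)
  nat (restrict k t) {a} g x = S-≡ a (genSourceNotTop g) (nat k g x)

  splitAll : (h : Hom P S) → incl ∘H h ≈H idH → ∀ {c} → Top c → (x : F₀ P c) → T c x
  splitAll h split {c} tp x = subst (T c) (split c x) (fromOnTop tp (proj₂ (η h c x)))

repInduction : ∀ {c₀ R μ} (T : ∀ c → F₀ R c → Set) → Representable c₀ R μ →
               OnTop c₀ (T c₀ μ) → ∀ {c} → Top c → (x : F₀ R c) → T c x
repInduction {R = R} {μ} T rep t = splitAll h split
  where
  open TopRestriction R T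
  h : Hom R S
  h = proj₁ (repMed rep S (μ , t))
  split : incl ∘H h ≈H idH
  split = repUnique rep (incl ∘H h) idH (cong proj₁ (proj₂ (repMed rep S (μ , t))))

poInduction : ∀ {A B C P} {f : Hom A B} {g : Hom A C} {i : Hom B P} {j : Hom C P}
  (T : ∀ c → F₀ P c → Set) → Pushout f g i j → NoTop A →
  (∀ {c} → Top c → (w : F₀ B c) → T c (η i c w)) →
  (∀ {c} → Top c → (z : F₀ C c) → T c (η j c z)) →
  ∀ {c} → Top c → (x : F₀ P c) → T c x
poInduction {i = i} {j = j} T po@(pushout (square , _)) noTopA onB onC = splitAll h split
  where
  open TopRestriction _ T
  med = poMed po (restrict i onB) (restrict j onC)
          (λ c x → S-≡ c (λ tp → noTopA tp x) (square c x))
  h = proj₁ med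
  split : incl ∘H h ≈H idH
  split = poUnique po (incl ∘H h) idH
            (λ c x → cong proj₁ (proj₁ (proj₂ med) c x))
            (λ c x → cong proj₁ (proj₂ (proj₂ med) c x))

playInduction : ∀ {X} (P : Play X) (T : ∀ c → F₀ (Play.U P) c → Set) →
  (∀ k → k ≤ᴸ Chain.len (Play.chain P) → NoTop (Chain.Xs (Play.chain P) k)) →
  (∀ k p {c} → Top c → (w : F₀ (Chain.Ms (Play.chain P) k) c) →
     T c (η (Cocone.v (Play.cocone P) k p) c w)) →
  ∀ {c} → Top c → (x : F₀ (Play.U P) c) → T c x
playInduction P T noTopXs onMs = splitAll h split
  where
  open Chain (Play.chain P)
  open Cocone (Play.cocone P)
  open TopRestriction (Play.U P) T
  κS : Cocone (Play.chain P) S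
  Cocone.u κS k p = restrict (u k p) (λ tp x → ⊥-elim (noTopXs k p tp x))
  Cocone.v κS k p = restrict (v k p) (onMs k p)
  Cocone.comf κS k p c y = S-≡ c (λ tp → noTopXs k (<ᴸ⇒≤ᴸ k len p) tp y) (comf k p c y)
  Cocone.comg κS k p c y = S-≡ c (λ tp → noTopXs (suc k) (<ᴸ⇒suc≤ᴸ k len p) tp y) (comg k p c y)
  med = playMed P S κS
  h = proj₁ med
  split : incl ∘H h ≈H idH
  split = playUnique P (incl ∘H h) idH
            (λ k p c x → cong proj₁ (proj₁ (proj₂ med) k p c x))
            (λ k p c x → cong proj₁ (proj₂ (proj₂ med) k p c x))

Element : Presheaf → Set
Element F = Σ Obj (F₀ F)

image : ∀ {F G} → Hom F G → Element F → Element G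
image h (c , x) = c , η h c x

repNoTop : ∀ {n R μ} → Representable (ag n) R μ → NoTop R
repNoTop rep = repInduction (λ _ _ → ⊥) rep tt

poNoTop : ∀ {A B C P} {f : Hom A B} {g : Hom A C} {i : Hom B P} {j : Hom C P} →
          Pushout f g i j → NoTop B → NoTop C → NoTop P
poNoTop {f = f} po noTopB noTopC =
  poInduction (λ _ _ → ⊥) po (λ tp x → noTopB tp (η f _ x)) noTopB noTopC

repTop : ∀ {c₀ R μ} → Representable c₀ R μ →
         ∀ {c} → Top c → (x : F₀ R c) → _≡_ {A = Element R} (c , x) (c₀ , μ)
repTop {c₀} {R} {μ} rep =
  repInduction (λ c x → _≡_ {A = Element R} (c , x) (c₀ , μ)) rep (onTop c₀ (λ _ → refl))

poTop : ∀ {A B C P} {f : Hom A B} {g : Hom A C} {i : Hom B P} {j : Hom C P} →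
        Pushout f g i j → NoTop A → NoTop C →
        ∀ {c} → Top c → (x : F₀ P c) → Σ (F₀ B c) (λ w → η i c w ≡ x)
poTop {B = B} {i = i} po noTopA noTopC =
  poInduction (λ c x → Σ (F₀ B c) (λ w → η i c w ≡ x)) po noTopA
    (λ tp w → w , refl) (λ tp z → ⊥-elim (noTopC tp z))

StarOnly : Presheaf → Set
StarOnly I = ∀ c → c ≢ star → ¬ F₀ I c

-- The subterminal presheaf supported on ⋆; maps into it witness StarOnly.
StarPoint : Presheaf
F₀ StarPoint c = c ≡ star
F₁ StarPoint {b = star} () refl
resp StarPoint _ _ = uip _ _

starOnlyNoTop : ∀ {I} → StarOnly I → NoTop I
starOnlyNoTop so (topTick n)      = so _ (λ ())
starOnlyNoTop so (topNu n)        = so _ (λ ())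
starOnlyNoTop so (topPara n)      = so _ (λ ())
starOnlyNoTop so (topTau n i m j) = so _ (λ ())

coproductStarOnly : ∀ {n I e} → IsCoprodStar n I e → StarOnly I
coproductStarOnly cop c c≢⋆ x = c≢⋆ (η (proj₁ (cop StarPoint (λ _ → refl))) c x)

-- The labelling presheaf Q: a Boolean over each [n], and over the other
-- objects c the Booleans of the agent faces [n] → c (sources and targets, and
-- the two branches of a fork).  A morphism into Q labels the agents of a
-- presheaf; such labellings tell apart agents of a play.
Q₀ : Obj → Set
Q₀ star        = ⊤
Q₀ (ag n)      = Bool
Q₀ (tick n)    = Bool × Bool
Q₀ (paral n)   = Bool × Bool
Q₀ (parar n)   = Bool × Bool
Q₀ (nu n)      = Bool × Bool
Q₀ (para n)    = Bool × (Bool × Bool)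
Q₀ (ι⁺ n i)    = Bool × Bool
Q₀ (ι⁻ n i)    = Bool × Bool
Q₀ (τ n i m j) = (Bool × Bool) × (Bool × Bool)

Q₁ : ∀ {a b} → Gen a b → Q₀ b → Q₀ a
Q₁ (d n x)      _ = tt
Q₁ (sTick n)    x = proj₁ x
Q₁ (tTick n)    x = proj₂ x
Q₁ (sParal n)   x = proj₁ x
Q₁ (tParal n)   x = proj₂ x
Q₁ (sParar n)   x = proj₁ x
Q₁ (tParar n)   x = proj₂ x
Q₁ (sι⁺ n i)    x = proj₁ x
Q₁ (tι⁺ n i)    x = proj₂ x
Q₁ (sι⁻ n i)    x = proj₁ x
Q₁ (tι⁻ n i)    x = proj₂ x
Q₁ (sNu n)      x = proj₁ x
Q₁ (tNu n)      x = proj₂ x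
Q₁ (l n)        x = proj₁ x , proj₁ (proj₂ x)
Q₁ (r n)        x = proj₁ x , proj₂ (proj₂ x)
Q₁ (ε n i m j)  x = proj₁ x
Q₁ (ρ n i m j)  x = proj₂ x

Qp : Presheaf
F₀ Qp = Q₀
F₁ Qp = Q₁
resp Qp (stTick n i)  x = refl
resp Qp (stParal n i) x = refl
resp Qp (stParar n i) x = refl
resp Qp (stι⁺ n k i)  x = refl
resp Qp (stι⁻ n k i)  x = refl
resp Qp (stNu n i)    x = refl
resp Qp (lr n)        x = refl
resp Qp (ερ n i m j)  x = refl

constQ : Bool → (c : Obj) → Q₀ c
constQ b star        = tt
constQ b (ag n)      = b
constQ b (tick n)    = b , b
constQ b (paral n)   = b , b
constQ b (parar n)   = b , b
constQ b (nu n)      = b , b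
constQ b (para n)    = b , (b , b)
constQ b (ι⁺ n i)    = b , b
constQ b (ι⁻ n i)    = b , b
constQ b (τ n i m j) = (b , b) , (b , b)

constQ-nat : ∀ b {a c} (g : Gen a c) → constQ b a ≡ Q₁ g (constQ b c)
constQ-nat b (d n x)     = refl
constQ-nat b (sTick n)   = refl
constQ-nat b (tTick n)   = refl
constQ-nat b (sParal n)  = refl
constQ-nat b (tParal n)  = refl
constQ-nat b (sParar n)  = refl
constQ-nat b (tParar n)  = refl
constQ-nat b (sι⁺ n i)   = refl
constQ-nat b (tι⁺ n i)   = refl
constQ-nat b (sι⁻ n i)   = refl
constQ-nat b (tι⁻ n i)   = refl
constQ-nat b (sNu n)     = refl
constQ-nat b (tNu n)     = refl
constQ-nat b (l n)       = refl
constQ-nat b (r n)       = refl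
constQ-nat b (ε n i m j) = refl
constQ-nat b (ρ n i m j) = refl

constB : ∀ {F} → Bool → Hom F Qp
η (constB b) c _ = constQ b c
nat (constB b) g x = constQ-nat b g

-- Labellings of a star-only presheaf are unique (Q has one element over ⋆);
-- this makes labellings of the two legs of a move pushout always compatible.
starOnlyLabelUnique : ∀ {I} → StarOnly I → (h h' : Hom I Qp) → h ≈H h'
starOnlyLabelUnique so h h' star        x = refl
starOnlyLabelUnique so h h' (ag n)      x = ⊥-elim (so _ (λ ()) x)
starOnlyLabelUnique so h h' (tick n)    x = ⊥-elim (so _ (λ ()) x)
starOnlyLabelUnique so h h' (paral n)   x = ⊥-elim (so _ (λ ()) x)
starOnlyLabelUnique so h h' (parar n)   x = ⊥-elim (so _ (λ ()) x)
starOnlyLabelUnique so h h' (nu n)      x = ⊥-elim (so _ (λ ()) x)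
starOnlyLabelUnique so h h' (para n)    x = ⊥-elim (so _ (λ ()) x)
starOnlyLabelUnique so h h' (ι⁺ n i)    x = ⊥-elim (so _ (λ ()) x)
starOnlyLabelUnique so h h' (ι⁻ n i)    x = ⊥-elim (so _ (λ ()) x)
starOnlyLabelUnique so h h' (τ n i m j) x = ⊥-elim (so _ (λ ()) x)

viaFace : ∀ {X M Q} (s : Hom X M) (T : Hom M Q) {a b} (p : Path a b) {x : F₀ X a} {m : F₀ M b} →
          η s a x ≡ act M p m → η T a (η s a x) ≡ act Q p (η T b m)
viaFace s T p {m = m} e = trans (cong (η T _) e) (actHom T p m)

Relabelling : Move → Set
Relabelling mv =
  (Ws : Hom X Qp) (Wt : Hom Y Qp) → Σ (Hom M Qp) (λ T → (T ∘H s ≈H Ws) × (T ∘H t ≈H Wt))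
  where open Move mv

record MoveShape (mv : Move) : Set₁ where
  open Move mv
  field
    apexObj           : Obj
    top               : Top apexObj
    μ                 : F₀ M apexObj
    generic           : Representable apexObj M μ
    x₀                : F₀ X (ag (arity top))
    face              : η s (ag (arity top)) x₀ ≡ act M (principalFace top) μ
    targetNoTop       : NoTop Y
    interfaceStarOnly : StarOnly I
    relabel           : Relabelling mv

-- X and Y are
-- representables or pushouts of representables on agents, and `relabel`
-- labels the generic element μ by the labels of its agent faces.
tickShape : ∀ {mv} n → IsTickMove n mv → MoveShape mv
tickShape {mv} n (_ , x , m , y , cop , repX , repM , repY , sx , ty , _ , _) = record
  { apexObj = tick n ; top = topTick n ; μ = m ; generic = representable repM ; x₀ = x ; face = sx
  ; targetNoTop = repNoTop (representable repY)
  ; interfaceStarOnly = coproductStarOnly cop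
  ; relabel = relabel }
  where
  open Move mv
  relabel : Relabelling mv
  relabel Ws Wt = T , onX , onY
    where
    med = repMed (representable repM) Qp (η Ws (ag n) x , η Wt (ag n) y)
    T = proj₁ med
    onX = repUnique (representable repX) (T ∘H s) Ws
            (trans (viaFace s T (sTick n ∷ []) sx) (cong proj₁ (proj₂ med)))
    onY = repUnique (representable repY) (T ∘H t) Wt
            (trans (viaFace t T (tTick n ∷ []) ty) (cong proj₂ (proj₂ med)))

nuShape : ∀ {mv} n → IsNuMove n mv → MoveShape mv
nuShape {mv} n (_ , x , m , y , cop , repX , repM , repY , sx , ty , _ , _) = record
  { apexObj = nu n ; top = topNu n ; μ = m ; generic = representable repM ; x₀ = x ; face = sx
  ; targetNoTop = repNoTop (representable repY)
  ; interfaceStarOnly = coproductStarOnly cop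
  ; relabel = relabel }
  where
  open Move mv
  relabel : Relabelling mv
  relabel Ws Wt = T , onX , onY
    where
    med = repMed (representable repM) Qp (η Ws (ag n) x , η Wt (ag (suc n)) y)
    T = proj₁ med
    onX = repUnique (representable repX) (T ∘H s) Ws
            (trans (viaFace s T (sNu n ∷ []) sx) (cong proj₁ (proj₂ med)))
    onY = repUnique (representable repY) (T ∘H t) Wt
            (trans (viaFace t T (tNu n ∷ []) ty) (cong proj₂ (proj₂ med)))

forkShape : ∀ {mv} n → IsForkMove n mv → MoveShape mv
forkShape {mv} n (_ , x , m , _ , _ , y₁ , y₂ , a₁ , a₂ , in₁ , in₂ , cop , repX , repM , rep₁ , rep₂ ,
                  _ , _ , po , _ , _ , sx , t₁ , t₂) = record
  { apexObj = para n ; top = topPara n ; μ = m ; generic = representable repM ; x₀ = x ; face = sx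
  ; targetNoTop = poNoTop targetPushout (repNoTop (representable rep₁)) (repNoTop (representable rep₂))
  ; interfaceStarOnly = coproductStarOnly cop
  ; relabel = relabel }
  where
  open Move mv
  targetPushout : Pushout a₁ a₂ in₁ in₂
  targetPushout = pushout po
  relabel : Relabelling mv
  relabel Ws Wt = T , onX , onY
    where
    med = repMed (representable repM) Qp
            (η Ws (ag n) x , η Wt (ag n) (η in₁ (ag n) y₁) , η Wt (ag n) (η in₂ (ag n) y₂))
    T = proj₁ med
    onX = repUnique (representable repX) (T ∘H s) Ws
            (trans (viaFace s T (sParal n ∷ l n ∷ []) sx) (cong proj₁ (proj₂ med)))
    onY = poUnique targetPushout (T ∘H t) Wt
            (repUnique (representable rep₁) ((T ∘H t) ∘H in₁) (Wt ∘H in₁)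
              (trans (viaFace t T (tParal n ∷ l n ∷ []) t₁) (cong (proj₁ ∘ proj₂) (proj₂ med))))
            (repUnique (representable rep₂) ((T ∘H t) ∘H in₂) (Wt ∘H in₂)
              (trans (viaFace t T (tParar n ∷ r n ∷ []) t₂) (cong (proj₂ ∘ proj₂) (proj₂ med))))

syncShape : ∀ {mv} n i k j → IsSyncMove n i k j mv → MoveShape mv
syncShape {mv} n i k j (_ , _ , _ , a , b , _ , m , f₁ , f₂ , in₁ , in₂ , in₁' , in₂' , _ ,
                        repn , repm , _ , repM , _ , _ , poX , poY , _ , _ , s₁ , s₂ , t₁ , t₂ ,
                        channels , _) = record
  { apexObj = τ n i k j ; top = topTau n i k j ; μ = m ; generic = representable repM
  ; x₀ = η in₁ (ag n) a ; face = s₁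
  ; targetNoTop = poNoTop targetPushout (repNoTop (representable repn)) (repNoTop (representable repm))
  ; interfaceStarOnly = proj₁ channels
  ; relabel = relabel }
  where
  open Move mv
  sourcePushout : Pushout f₁ f₂ in₁ in₂
  sourcePushout = pushout poX
  targetPushout : Pushout f₁ f₂ in₁' in₂'
  targetPushout = pushout poY
  relabel : Relabelling mv
  relabel Ws Wt = T , onX , onY
    where
    med = repMed (representable repM) Qp
            ((η Ws (ag n) (η in₁ (ag n) a) , η Wt (ag n) (η in₁' (ag n) a)) ,
             (η Ws (ag k) (η in₂ (ag k) b) , η Wt (ag k) (η in₂' (ag k) b)))
    T = proj₁ med
    onX = poUnique sourcePushout (T ∘H s) Ws
            (repUnique (representable repn) ((T ∘H s) ∘H in₁) (Ws ∘H in₁)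
              (trans (viaFace s T (sι⁺ n i ∷ ε n i k j ∷ []) s₁)
                     (cong (proj₁ ∘ proj₁) (proj₂ med))))
            (repUnique (representable repm) ((T ∘H s) ∘H in₂) (Ws ∘H in₂)
              (trans (viaFace s T (sι⁻ k j ∷ ρ n i k j ∷ []) s₂)
                     (cong (proj₁ ∘ proj₂) (proj₂ med))))
    onY = poUnique targetPushout (T ∘H t) Wt
            (repUnique (representable repn) ((T ∘H t) ∘H in₁') (Wt ∘H in₁')
              (trans (viaFace t T (tι⁺ n i ∷ ε n i k j ∷ []) t₁)
                     (cong (proj₂ ∘ proj₁) (proj₂ med))))
            (repUnique (representable repm) ((T ∘H t) ∘H in₂') (Wt ∘H in₂')
              (trans (viaFace t T (tι⁻ k j ∷ ρ n i k j ∷ []) t₂)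
                     (cong (proj₂ ∘ proj₂) (proj₂ med))))

moveShape : ∀ {mv} → IsMove mv → MoveShape mv
moveShape (inj₁ (n , mv))                           = tickShape n mv
moveShape (inj₂ (inj₁ (n , mv)))                    = nuShape n mv
moveShape (inj₂ (inj₂ (inj₁ (n , mv))))             = forkShape n mv
moveShape (inj₂ (inj₂ (inj₂ (n , i , k , j , mv)))) = syncShape n i k j mv

record ExtendedMove {A B C} (f : Hom A B) (g : Hom C B) : Set₁ where
  field
    mv    : Move
    shape : MoveShape mv
  open Move mv public
  open MoveShape shape public
  field
    Z    : Presheaf
    h    : Hom I Z
    xA   : Hom X A
    zA   : Hom Z A
    mB   : Hom M B
    zB   : Hom Z B
    yC   : Hom Y C
    zC   : Hom Z C
    posZ : Position Z
    poA  : Pushout iX h xA zA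
    poM  : Pushout (s ∘H iX) h mB zB
    poC  : Pushout iY h yC zC
    fx   : f ∘H xA ≈H mB ∘H s
    fz   : f ∘H zA ≈H zB
    gy   : g ∘H yC ≈H mB ∘H t
    gz   : g ∘H zC ≈H zB

  contextNoTop : NoTop Z
  contextNoTop = positionNoTop {Z} posZ

unpack : ∀ {A B C} {f : Hom A B} {g : Hom C B} → IsExtMove f g → ExtendedMove f g
unpack (mv , isMove , Z , h , xA , zA , mB , zB , yC , zC , posZ , poA , poM , poC , fx , fz , gy , gz) =
  record { mv = mv ; shape = moveShape isMove ; Z = Z ; h = h ; xA = xA ; zA = zA ; mB = mB ; zB = zB
         ; yC = yC ; zC = zC ; posZ = posZ ; poA = pushout poA ; poM = pushout poM ; poC = pushout poC
         ; fx = fx ; fz = fz ; gy = gy ; gz = gz }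

≤ᴸ-irrelevant : ∀ k L (p q : k ≤ᴸ L) → p ≡ q
≤ᴸ-irrelevant k (fin n) p q = ≤-irrelevant p q
≤ᴸ-irrelevant k inf     p q = refl

<ᴸ-irrelevant : ∀ k L (p q : k <ᴸ L) → p ≡ q
<ᴸ-irrelevant k (fin n) p q = ≤-irrelevant p q
<ᴸ-irrelevant k inf     p q = refl

<ᴸ-recompute : ∀ k L → .(k <ᴸ L) → k <ᴸ L
<ᴸ-recompute k (fin n) p = recompute (k <? n) p
<ᴸ-recompute k inf     p = tt

suc≤ᴸ⇒<ᴸ : ∀ k L → suc k ≤ᴸ L → k <ᴸ L
suc≤ᴸ⇒<ᴸ k (fin n) p = p
suc≤ᴸ⇒<ᴸ k inf     p = tt

≤-<ᴸ-trans : ∀ {k j} L → k ≤ j → j <ᴸ L → k <ᴸ L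
≤-<ᴸ-trans (fin n) k≤j j<n = ≤-<-trans k≤j j<n
≤-<ᴸ-trans inf     k≤j _   = tt

module ChainFacts {X} (C : Chain X) where
  open Chain C

  -- The extended move at stage k; the bound is irrelevant, so it depends on k only.
  stage : ∀ k → .(k <ᴸ len) → ExtendedMove (f k) (g k)
  stage k p = unpack (ext k (<ᴸ-recompute k len p))

  module Stage (k : ℕ) .(p : k <ᴸ len) where
    open ExtendedMove (stage k p) public

  module _ {Q} (κ : Cocone C Q) where
    open Cocone κ

    u-irr : ∀ k (p p' : k ≤ᴸ len) → u k p ≈H u k p'
    u-irr k p p' rewrite ≤ᴸ-irrelevant k len p p' = λ _ _ → refl

    v-irr : ∀ k (p p' : k <ᴸ len) → v k p ≈H v k p'
    v-irr k p p' rewrite <ᴸ-irrelevant k len p p' = λ _ _ → refl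

    apexFace : ∀ k (p : k <ᴸ len) → let open Stage k p in
      act Q (principalFace top) (η (v k p ∘H mB) apexObj μ) ≡ η (u k (<ᴸ⇒≤ᴸ k len p)) _ (η xA _ x₀)
    apexFace k p = begin
      act Q (principalFace top) (η (v k p ∘H mB) apexObj μ)
        ≡⟨ sym (actHom (v k p ∘H mB) (principalFace top) μ) ⟩
      η (v k p ∘H mB) _ (act M (principalFace top) μ)
        ≡⟨ cong (η (v k p ∘H mB) _) (sym face) ⟩
      η (v k p) _ (η mB _ (η s _ x₀))
        ≡⟨ cong (η (v k p) _) (sym (fx _ x₀)) ⟩
      η (v k p) _ (η (f k) _ (η xA _ x₀))
        ≡⟨ comf k p _ (η xA _ x₀) ⟩
      η (u k (<ᴸ⇒≤ᴸ k len p)) _ (η xA _ x₀)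
        ∎
      where open Stage k p
            open ≡-Reasoning

FaceInjective : Presheaf → Set
FaceInjective V = ∀ {c} (tp : Top c) (e e' : F₀ V c) →
  act V (principalFace tp) e ≡ act V (principalFace tp) e' → e ≡ e'

agreeAlong : ∀ {F H V} (t t' : Hom F H) (a b : Hom H V) →
             t ≈H t' → a ∘H t' ≈H b ∘H t' → a ∘H t ≈H b ∘H t
agreeAlong t t' a b t≈t' ab c x =
  trans (cong (η a c) (t≈t' c x)) (trans (ab c x) (cong (η b c) (sym (t≈t' c x))))

-- By induction along the chain, they
-- agree on each X_k and each M_k = M +_I Z: on Z because Z → M_k factors
-- through X_k, on the representable apex M because its generic element is
-- determined by its principal face, which comes from X_k.
agreeOnPlay : ∀ {X} (P : Play X) {V} → FaceInjective V → (a b : Hom (Play.U P) V) →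
              a ∘H Play.incl P ≈H b ∘H Play.incl P → a ≈H b
agreeOnPlay P {V} injective a b onX = playUnique P a b onPositions onMoves
  where
  open Chain (Play.chain P)
  open Cocone (Play.cocone P)
  open ChainFacts (Play.chain P)
  mutual
    onPositions : ∀ k p → a ∘H u k p ≈H b ∘H u k p
    onPositions zero    p =
      agreeAlong (u 0 p) (Play.incl P) a b (u-irr (Play.cocone P) 0 p (0≤ᴸ len)) onX
    onPositions (suc k) p =
      agreeAlong (u (suc k) p) (v k q ∘H g k) a b covered (λ c x → onMoves k q c (η (g k) c x))
      where
      q = suc≤ᴸ⇒<ᴸ k len p
      covered : u (suc k) p ≈H v k q ∘H g k
      covered c x = trans (u-irr (Play.cocone P) (suc k) p _ c x) (sym (comg k q c x))

    onMoves : ∀ k p → a ∘H v k p ≈H b ∘H v k p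
    onMoves k p = poUnique poM (a ∘H v k p) (b ∘H v k p) onApex onContext
      where
      open Stage k p
      p' = <ᴸ⇒≤ᴸ k len p
      contextInXk : v k p ∘H zB ≈H u k p' ∘H zA
      contextInXk c z = trans (cong (η (v k p) c) (sym (fz c z))) (comf k p c (η zA c z))
      onContext : (a ∘H v k p) ∘H zB ≈H (b ∘H v k p) ∘H zB
      onContext = agreeAlong (v k p ∘H zB) (u k p' ∘H zA) a b contextInXk
                    (λ c z → onPositions k p' c (η zA c z))
      apex = η (v k p ∘H mB) apexObj μ
      faceOfImage : ∀ (w : Hom (Play.U P) V) →
        act V (principalFace top) (η w apexObj apex) ≡ η w _ (η (u k p') _ (η xA _ x₀))
      faceOfImage w = trans (sym (actHom w (principalFace top) apex))
                            (cong (η w _) (apexFace (Play.cocone P) k p))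
      onApex : (a ∘H v k p) ∘H mB ≈H (b ∘H v k p) ∘H mB
      onApex = repUnique generic ((a ∘H v k p) ∘H mB) ((b ∘H v k p) ∘H mB) (injective top _ _
        (trans (faceOfImage a) (trans (onPositions k p' _ _) (sym (faceOfImage b)))))

Agent : Presheaf → Set
Agent F = Σ ℕ (λ n → F₀ F (ag n))

principalAgent : ∀ F {c} → Top c → F₀ F c → Agent F
principalAgent F tp x = arity tp , act F (principalFace tp) x

principalAgent-cong : ∀ F {c c'} (tp : Top c) (tp' : Top c') {x : F₀ F c} {x' : F₀ F c'} →
  _≡_ {A = Element F} (c , x) (c' , x') → principalAgent F tp x ≡ principalAgent F tp' x'
principalAgent-cong F tp tp' refl rewrite topIrr tp tp' = refl

mapAgent : ∀ {F G} → Hom F G → Agent F → Agent G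
mapAgent h (n , x) = n , η h (ag n) x

label : Agent Qp → Bool
label (n , b) = b

module PlayFaces {X} (posX : Position X) (P : Play X) where
  open Play P
  open Chain chain
  open Cocone cocone
  open ChainFacts chain

  positionsNoTop : ∀ k → k ≤ᴸ len → NoTop (Xs k)
  positionsNoTop zero    _ = positionNoTop {X} posX
  positionsNoTop (suc k) p = poNoTop poC targetNoTop contextNoTop
    where open Stage k (suc≤ᴸ⇒<ᴸ k len p)

  apex : ∀ j → j <ᴸ len → Element U
  apex j p = apexObj , η (v j p ∘H mB) apexObj μ
    where open Stage j p

  agent : ∀ j → j <ᴸ len → Agent U
  agent j p = arity top , η (u j (<ᴸ⇒≤ᴸ j len p)) _ (η xA _ x₀)
    where open Stage j p

  apex-irr : ∀ j (p p' : j <ᴸ len) → apex j p ≡ apex j p'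
  apex-irr j p p' = cong (apexObj ,_) (v-irr cocone j p p' apexObj (η mB apexObj μ))
    where open Stage j p

  apexAgent : ∀ j p → principalAgent U (Stage.top j p) (proj₂ (apex j p)) ≡ agent j p
  apexAgent j p = cong (arity top ,_) (apexFace cocone j p)
    where open Stage j p

  -- Every top element of U is the apex of some move: it comes from some M_k,
  -- hence from its representable apex M, hence it is the generic element.
  Located : ∀ c → F₀ U c → Set
  Located c e = Σ ℕ λ j → Σ (j <ᴸ len) λ p → (c , e) ≡ apex j p

  locate : ∀ {c} → Top c → (e : F₀ U c) → Located c e
  locate = playInduction P Located positionsNoTop atApex
    where
    atApex : ∀ k p {c} → Top c → (w : F₀ (Ms k) c) → Located c (η (v k p) c w)
    atApex k p tp w = k , p , trans (cong (image (v k p)) fromApex)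
                                    (cong (image (v k p ∘H mB)) (repTop generic tp (proj₁ inApex)))
      where
      open Stage k p
      inApex = poTop poM (starOnlyNoTop {I} interfaceStarOnly) contextNoTop tp w
      fromApex : _≡_ {A = Element (Ms k)} (_ , w) (_ , η mB _ (proj₁ inApex))
      fromApex = cong (_ ,_) (sym (proj₂ inApex))

  -- For a stage j₀, a cocone into Q marking an agent of X_k iff it survives
  -- unchanged, through the contexts Z, until it is consumed at stage j₀.
  module Separation (j₀ : ℕ) (p₀ : j₀ <ᴸ len) where

    isTarget : ℕ → Bool
    isTarget k = does (k ≟ j₀)

    bounded : ∀ k m → k + m ≡ j₀ → k <ᴸ len
    bounded k m e = ≤-<ᴸ-trans len (subst (k ≤_) e (m≤m+n k m)) p₀

    -- For k + m = j₀, by recursion on the distance m: the labelling of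
    -- X_k = X +_I Z marking the agent consumed by move k iff k = j₀, and
    -- labelling the context Z as its image in X_{k+1} (unmarked if k = j₀).
    mutual
      ancestry : ∀ m k → k + m ≡ j₀ → Hom (Xs k) Qp
      ancestry m k e = proj₁ (ancestry-spec m k e)

      ancestryNext : ∀ m k → k + m ≡ j₀ → Hom (Xs (suc k)) Qp
      ancestryNext zero    k e = constB false
      ancestryNext (suc m) k e = ancestry m (suc k) (trans (sym (+-suc k m)) e)

      ancestry-spec : ∀ m k (e : k + m ≡ j₀) → let open Stage k (bounded k m e) in
        Σ (Hom (Xs k) Qp) (λ lab → (lab ∘H xA ≈H constB (isTarget k))
                                 × (lab ∘H zA ≈H ancestryNext m k e ∘H zC))
      ancestry-spec m k e = poMed poA (constB (isTarget k)) (ancestryNext m k e ∘H zC)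
        (starOnlyLabelUnique interfaceStarOnly (constB (isTarget k) ∘H iX)
                                               ((ancestryNext m k e ∘H zC) ∘H h))
        where open Stage k (bounded k m e)

    -- the distance m is determined by k, and equality proofs on ℕ are unique
    ancestry-irr : ∀ m m' k (e : k + m ≡ j₀) (e' : k + m' ≡ j₀) →
                   ancestry m k e ≈H ancestry m' k e'
    ancestry-irr m m' k e e' with +-cancelˡ-≡ k m m' (trans e (sym e'))
    ... | refl with ≡-irrelevant e e'
    ... | refl = λ _ _ → refl

    labelX : ∀ k → Hom (Xs k) Qp
    labelX k with k ≤? j₀
    ... | yes k≤j₀ = ancestry (j₀ ∸ k) k (m+[n∸m]≡n k≤j₀)
    ... | no  _    = constB false

    labelX-below : ∀ m k (e : k + m ≡ j₀) → labelX k ≈H ancestry m k e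
    labelX-below m k e with k ≤? j₀
    ... | yes k≤j₀ = ancestry-irr (j₀ ∸ k) m k (m+[n∸m]≡n k≤j₀) e
    ... | no  k≰j₀ = ⊥-elim (k≰j₀ (subst (k ≤_) e (m≤m+n k m)))

    labelX-above : ∀ k → ¬ k ≤ j₀ → labelX k ≈H constB false
    labelX-above k k≰j₀ with k ≤? j₀
    ... | yes k≤j₀ = ⊥-elim (k≰j₀ k≤j₀)
    ... | no  _    = λ _ _ → refl

    labelX-next : ∀ m k (e : k + m ≡ j₀) → ancestryNext m k e ≈H labelX (suc k)
    labelX-next zero    k e c x = sym (labelX-above (suc k) sk≰j₀ c x)
      where sk≰j₀ = <-irrefl (trans (sym (+-identityʳ k)) e)
    labelX-next (suc m) k e c x = sym (labelX-below m (suc k) _ c x)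

    Consistent : ∀ k → .(k <ᴸ len) → Set
    Consistent k p = (labelX k ∘H xA ≈H constB (isTarget k))
                   × (labelX k ∘H zA ≈H labelX (suc k) ∘H zC)
      where open Stage k p

    labelX-consistent : ∀ k .(p : k <ᴸ len) → Consistent k p
    labelX-consistent k p = byCases (k ≤? j₀)
      where
      open Stage k p
      byCases : Dec (k ≤ j₀) → Consistent k p
      byCases (yes k≤j₀) =
          (λ c x → trans (labelX-below m k e c _) (proj₁ (proj₂ spec) c x))
        , (λ c z → trans (labelX-below m k e c _)
                         (trans (proj₂ (proj₂ spec) c z) (labelX-next m k e c _)))
        where
        m = j₀ ∸ k
        e = m+[n∸m]≡n k≤j₀
        spec = ancestry-spec m k e
      byCases (no k≰j₀) =
          (λ c x → trans (labelX-above k k≰j₀ c _) (cong (λ b → constQ b c) (sym notTarget)))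
        , (λ c z → trans (labelX-above k k≰j₀ c _) (sym (labelX-above (suc k) sk≰j₀ c _)))
        where
        notTarget : isTarget k ≡ false
        notTarget = dec-false (k ≟ j₀) (λ k≡j₀ → k≰j₀ (subst (k ≤_) k≡j₀ ≤-refl))
        sk≰j₀ : ¬ suc k ≤ j₀
        sk≰j₀ sk≤j₀ = k≰j₀ (≤-trans (n≤1+n k) sk≤j₀)

    -- The labelling of M_k = M +_I Z: on the apex M by `relabel` (source as
    -- in X_k, target as in X_{k+1}), on the context Z as in X_{k+1}.
    labelApex : ∀ k .(p : k <ᴸ len) → let open Stage k p in
      Σ (Hom M Qp) (λ T → (T ∘H s ≈H constB (isTarget k)) × (T ∘H t ≈H labelX (suc k) ∘H yC))
    labelApex k p = relabel (constB (isTarget k)) (labelX (suc k) ∘H yC)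
      where open Stage k p

    labelM-spec : ∀ k .(p : k <ᴸ len) → let open Stage k p in
      Σ (Hom (Ms k) Qp) (λ lab → (lab ∘H mB ≈H proj₁ (labelApex k p))
                               × (lab ∘H zB ≈H labelX (suc k) ∘H zC))
    labelM-spec k p = poMed poM (proj₁ (labelApex k p)) (labelX (suc k) ∘H zC)
      (starOnlyLabelUnique interfaceStarOnly (proj₁ (labelApex k p) ∘H (s ∘H iX))
                                             ((labelX (suc k) ∘H zC) ∘H h))
      where open Stage k p

    labelM : ∀ k → .(k <ᴸ len) → Hom (Ms k) Qp
    labelM k p = proj₁ (labelM-spec k p)

    labelM-f : ∀ k .(p : k <ᴸ len) → labelM k p ∘H f k ≈H labelX k
    labelM-f k p = poUnique poA (labelM k p ∘H f k) (labelX k) onX onZ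
      where
      open Stage k p
      onX : (labelM k p ∘H f k) ∘H xA ≈H labelX k ∘H xA
      onX c x = trans (cong (η (labelM k p) c) (fx c x))
                (trans (proj₁ (proj₂ (labelM-spec k p)) c (η s c x))
                (trans (proj₁ (proj₂ (labelApex k p)) c x)
                       (sym (proj₁ (labelX-consistent k p) c x))))
      onZ : (labelM k p ∘H f k) ∘H zA ≈H labelX k ∘H zA
      onZ c z = trans (cong (η (labelM k p) c) (fz c z))
                (trans (proj₂ (proj₂ (labelM-spec k p)) c z)
                       (sym (proj₂ (labelX-consistent k p) c z)))

    labelM-g : ∀ k .(p : k <ᴸ len) → labelM k p ∘H g k ≈H labelX (suc k)
    labelM-g k p = poUnique poC (labelM k p ∘H g k) (labelX (suc k)) onY onZ
      where
      open Stage k p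
      onY : (labelM k p ∘H g k) ∘H yC ≈H labelX (suc k) ∘H yC
      onY c y = trans (cong (η (labelM k p) c) (gy c y))
                (trans (proj₁ (proj₂ (labelM-spec k p)) c (η t c y))
                       (proj₂ (proj₂ (labelApex k p)) c y))
      onZ : (labelM k p ∘H g k) ∘H zC ≈H labelX (suc k) ∘H zC
      onZ c z = trans (cong (η (labelM k p) c) (gz c z)) (proj₂ (proj₂ (labelM-spec k p)) c z)

    separatingCocone : Cocone chain Qp
    Cocone.u    separatingCocone k _ = labelX k
    Cocone.v    separatingCocone k p = labelM k p
    Cocone.comf separatingCocone k p = labelM-f k p
    Cocone.comg separatingCocone k p = labelM-g k p

  separate : ∀ j₀ → j₀ <ᴸ len →
    Σ (Hom U Qp) (λ Φ → ∀ j p → label (mapAgent Φ (agent j p)) ≡ does (j ≟ j₀))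
  separate j₀ p₀ = Φ , marks
    where
    open Separation j₀ p₀
    med = playMed P Qp separatingCocone
    Φ = proj₁ med
    marks : ∀ j p → label (mapAgent Φ (agent j p)) ≡ does (j ≟ j₀)
    marks j p = trans (proj₁ (proj₂ med) j _ _ _) (proj₁ (labelX-consistent j p) _ x₀)
      where open Stage j p

  agentsDistinct : ∀ j p j' p' → j' ≢ j → agent j p ≢ agent j' p'
  agentsDistinct j p j' p' j'≢j sameAgent = true≢false (begin
    true                                ≡⟨ sym (dec-true (j ≟ j) refl) ⟩
    does (j ≟ j)                        ≡⟨ sym (marks j p) ⟩
    label (mapAgent Φ (agent j p))      ≡⟨ cong (label ∘ mapAgent Φ) sameAgent ⟩
    label (mapAgent Φ (agent j' p'))    ≡⟨ marks j' p' ⟩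
    does (j' ≟ j)                       ≡⟨ dec-false (j' ≟ j) j'≢j ⟩
    false                               ∎)
    where
    open ≡-Reasoning
    Φ = proj₁ (separate j p)
    marks = proj₂ (separate j p)
    true≢false : true ≢ false
    true≢false ()

  -- Top elements with the same principal face are apices of moves consuming
  -- the same agent, hence of the same move, hence equal.
  faceInjective : FaceInjective U
  faceInjective tp e e' sameFace = sameApex (locate tp e) (locate tp e')
    where
    agentOf : ∀ {x} j p → (_ , x) ≡ apex j p → principalAgent U tp x ≡ agent j p
    agentOf j p at = trans (principalAgent-cong U tp (Stage.top j p) at) (apexAgent j p)

    sameApex : Located _ e → Located _ e' → e ≡ e'
    sameApex (j , p , at) (j' , p' , at') with j' ≟ j
    ... | yes refl = ,-injectiveʳ (trans at (trans (apex-irr j p p') (sym at')))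
    ... | no  j'≢j = ⊥-elim (agentsDistinct j p j' p' j'≢j
                       (trans (sym (agentOf j p at))
                              (trans (cong (arity tp ,_) sameFace) (agentOf j' p' at'))))

-- W(X) is a preorder: two morphisms k, k' : U → U' of plays both restrict to
-- the inclusion of X, and U' is face-injective.
mainTheorem7 : (X : Presheaf) → Position X →
    (P P' : Play X) (α β : WHom P P') → WHom.k α ≈H WHom.k β
mainTheorem7 X posX P P' α β =
  agreeOnPlay P (PlayFaces.faceInjective posX P') (WHom.k α) (WHom.k β)
    (λ c x → trans (WHom.comm α c x) (sym (WHom.comm β c x)))
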